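{- If $\emptyset\vdash M:(v,\mathsf{r})$ is derivable, where $M$ is a finite closed lambda-term of sort $\mathsf{o}$ in beta-normal form, then $\mathit{BT}(M)$ has a finite branch that, for every $a\in\Sigma_{\mathsf{a}}$, contains exactly $v(a)$ occurrences of $a$.
   Context: Fix $s\ge1$. Sorts are built from $\mathsf{o}$ by $\to$. Lambda-terms are simply-typed lambda-terms, up to alpha-conversion, over constants $\mathsf{a}_1,\dots,\mathsf{a}_s:\mathsf{o}\to\mathsf{o}$ (important constants, $\Sigma_{\mathsf{a}}=\{\mathsf{a}_1,\dots,\mathsf{a}_s\}$), $\mathsf{b}:\mathsf{o}\to\mathsf{o}\to\mathsf{o}$, $\mathsf{c},\omega:\mathsf{o}$. Böhm trees: a tree is a term $a\,T_1\dots T_r$ with $a$ a constant of arity $r$ and $T_i$ trees. A finite branch of a tree $a\,T_1\dots T_r$ is a sequence of constants $a_1,\dots,a_k$ with $a_1=a\neq\omega$ and either $k\ge2$ and $a_2,\dots,a_k$ is a finite branch of some $T_i$, or $r=0$ and $k=1$. For a closed $M$ of sort $\mathsf{o}$, $\mathit{BT}(M)$: if $M$ beta-reduces to $a\,M_1\dots M_r$ with $a$ a constant then $\mathit{BT}(M)=a\,\mathit{BT}(M_1)\dots\mathit{BT}(M_r)$, otherwise $\omega$ (for finite $M$ this is the beta-normal form). An $s$-multiset is a multiset with at most $s$ copies of each element; $\mathcal{P}_{\le s}(X)$ is the set of $s$-multisets of elements of $X$; the union $U\cup V$ of $s$-multisets contains $\min(n+m,s)$ copies of an element occurring $n$ times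 in $U$ and $m$ times in $V$; $\{x_i\mid i\in I\}$ denotes $\bigcup_{i\in I}\{x_i\}$ in this sense. Types: $\mathcal{T}_s^{\mathsf{o}}=\{\mathsf{r}\}$, $\mathcal{T}_s^{\alpha\to\beta}=\mathcal{P}_{\le s}(\mathcal{P}(\Sigma_{\mathsf{a}})\times\mathcal{T}_s^\alpha)\times\mathcal{T}_s^\beta$, written $\bigwedge_{i\in I}(A_i,\tau_i)\to\tau$ where each pair occurs as $(A_i,\tau_i)$ for at most $s$ indices; $\top$ is the empty one. Judgments $\Gamma\vdash M:(v,\tau)$ with $v:\Sigma_{\mathsf{a}}\to\mathbb{N}$, $\tau$ of the sort of $M$, $\Gamma$ an $s$-multiset of bindings $x:(A,\sigma)$ with $A\subseteq\Sigma_{\mathsf{a}}$ and $\sigma$ of the sort of $x$; $\mathit{dom}(\Gamma)$ is the set of bound variables; $\Gamma{\restriction}_a$ is the $s$-multiset of bindings of $\Gamma$ whose set contains $a$. $\mathbf{0}$ maps all of $\Sigma_{\mathsf{a}}$ to $0$; $\chi_i$ maps $\mathsf{a}_i$ to $1$ and the others to $0$; $\mathit{dupl}((\Gamma_j)_{j\in J})(a)=\sum_{j\in J}|\Gamma_j{\restriction}_a|-|\bigcup_{j\in J}\Gamma_j{\restriction}_a|$. Finite derivations use the rules: $\emptyset\vdash\mathsf{a}_i:(\chi_i,(A,\mathsf{r})\to\mathsf{r})$; $\emptyset\vdash\mathsf{c}:(\mathbf{0},\mathsf{r})$; $\emptyset\vdash\mathsf{b}:(\mathbf{0},(A,\mathsf{r})\to\top\to\mathsf{r})$;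 $\emptyset\vdash\mathsf{b}:(\mathbf{0},\top\to(A,\mathsf{r})\to\mathsf{r})$ (any $A$); $x:(A,\tau)\vdash x:(\mathbf{0},\tau)$; ($\lambda$): from $\Gamma\cup\{x:(A_i,\tau_i)\mid i\in I\}\vdash K:(v,\tau)$ with $x\notin\mathit{dom}(\Gamma)$ infer $\Gamma\vdash\lambda x.K:(v,\bigwedge_{i\in I}(A_i,\tau_i)\to\tau)$; ($@$): if $0\notin I$, $\Gamma_0\vdash K:(v_0,\bigwedge_{i\in I}(A_i,\tau_i)\to\tau)$, and for each $i\in I$, $\Gamma_i\vdash L:(v_i,\tau_i)$ with $A_i=\{a\in\Sigma_{\mathsf{a}}\mid v_i(a)>0\lor\Gamma_i{\restriction}_a\ne\emptyset\}$, infer $\bigcup_{i\in\{0\}\cup I}\Gamma_i\vdash K\,L:(\mathit{dupl}((\Gamma_i)_{i\in\{0\}\cup I})+\sum_{i\in\{0\}\cup I}v_i,\tau)$. No rule for $\omega$. -}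

module Defs where

open import Data.Nat using (ℕ; zero; suc; _+_; _∸_; _⊓_; _<ᵇ_; s≤s)
open import Data.Nat.Properties using (m⊓n≤n)
open import Data.Nat.ListAction using () renaming (sum to sumL)
open import Data.Fin as Fin using (Fin; toℕ; fromℕ<)
open import Data.Bool using (Bool; true; false; if_then_else_; _∨_)
open import Data.Unit using (⊤; tt)
open import Data.Product using (_×_; _,_; proj₁; proj₂)
import Data.Product.Properties as ×P
open import Data.List as L using (List; []; _∷_; length; cartesianProduct)
open import Data.Vec as V using (Vec; []; _∷_; lookup; tabulate; zipWith; replicate)
import Data.Vec.Properties as VP
open import Relation.Binary.PropositionalEquality using (_≡_; refl)
open import Relation.Binary.Definitions using (DecidableEquality)
open import Relation.Nullary using (yes; no)
open import Relation.Nullary.Decidable using (⌊_⌋)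

data Sort : Set where
  o   : Sort
  _⇒_ : Sort → Sort → Sort
infixr 5 _⇒_

-- All definitions below are parameterised by s (the paper's fixed s ≥ 1;
-- the hypothesis 1 ≤ s is added in the statement).
module _ (s : ℕ) where

  data Const : Sort → Set where
    a : Fin s → Const (o ⇒ o)
    b : Const (o ⇒ o ⇒ o)
    c : Const o
    ω : Const o

  data _∋_ : List Sort → Sort → Set where
    here  : ∀ {Δ σ} → (σ ∷ Δ) ∋ σ
    there : ∀ {Δ σ τ} → Δ ∋ σ → (τ ∷ Δ) ∋ σ

  data Tm (Δ : List Sort) : Sort → Set where
    var : ∀ {σ} → Δ ∋ σ → Tm Δ σ
    con : ∀ {σ} → Const σ → Tm Δ σ
    lam : ∀ {α β} → Tm (α ∷ Δ) β → Tm Δ (α ⇒ β)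
    app : ∀ {α β} → Tm Δ (α ⇒ β) → Tm Δ α → Tm Δ β

  isLam : ∀ {Δ σ} → Tm Δ σ → Bool
  isLam (lam _) = true
  isLam _       = false

  data BetaNormal {Δ : List Sort} : ∀ {σ} → Tm Δ σ → Set where
    nvar : ∀ {σ} (x : Δ ∋ σ) → BetaNormal (var x)
    ncon : ∀ {σ} (k : Const σ) → BetaNormal {σ = σ} (con k)
    nlam : ∀ {α β} {K : Tm (α ∷ Δ) β} → BetaNormal K → BetaNormal (lam K)
    napp : ∀ {α β} {K : Tm Δ (α ⇒ β)} {L : Tm Δ α} →
           isLam K ≡ false → BetaNormal K → BetaNormal L → BetaNormal (app K L)

  data Tree : Set where
    aT : Fin s → Tree → Tree
    bT : Tree → Tree → Tree
    cT : Tree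
    ωT : Tree

  -- For a finite closed term of sort o in beta-normal form, BT(M) is M
  -- itself read as a tree (M = a_i M₁, b M₁ M₂, c or ω).  The final
  -- catch-all clause is never reached on closed beta-normal terms.
  BT : Tm [] o → Tree
  BT (app (con (a i)) t)       = aT i (BT t)
  BT (app (app (con b) t) u)   = bT (BT t) (BT u)
  BT (con c)                   = cT
  BT (con ω)                   = ωT
  BT _                         = ωT

  data Label : Set where
    la : Fin s → Label
    lb lc lω : Label

  -- finite branches (ω never starts a branch)
  data Branch : Tree → List Label → Set where
    brA  : ∀ {i t w} → Branch t w → Branch (aT i t) (la i ∷ w)
    brB₁ : ∀ {t u w} → Branch t w → Branch (bT t u) (lb ∷ w)
    brB₂ : ∀ {t u w} → Branch u w → Branch (bT t u) (lb ∷ w)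
    brC  : Branch cT (lc ∷ [])

  occ : Fin s → List Label → ℕ
  occ i []           = 0
  occ i (la j ∷ w)   = (if ⌊ i Fin.≟ j ⌋ then 1 else 0) + occ i w
  occ i (_ ∷ w)      = occ i w

  -- Subsets of Σ_a as characteristic vectors (true = member)
  Sub : Set
  Sub = Vec Bool s

  allVecs : {A : Set} → List A → (n : ℕ) → List (Vec A n)
  allVecs xs zero    = [] ∷ []
  allVecs xs (suc n) = L.concatMap (λ x → L.map (x ∷_) (allVecs xs n)) xs

  allSubs : List Sub
  allSubs = allVecs (false ∷ true ∷ []) s

  -- multiplicities of an s-multiset: 0..s
  Cnt : Set
  Cnt = Fin (suc s)

  cap : ℕ → Cnt
  cap n = fromℕ< (s≤s (m⊓n≤n n s))

  _⊕_ : Cnt → Cnt → Cnt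
  x ⊕ y = cap (toℕ x + toℕ y)

  -- An s-multiset over the finite set P(Σ_a) × T_s^α is
  -- represented canonically as a vector of multiplicities indexed by a
  -- fixed duplicate-free enumeration  pairs α  of that set.
  mutual
    Ty : Sort → Set
    Ty o       = ⊤
    Ty (α ⇒ β) = Ms α × Ty β            -- ⋀_{i∈I}(A_i,τ_i) → τ

    Ms : Sort → Set
    Ms α = Vec Cnt (length (pairs α))

    pairs : (α : Sort) → List (Sub × Ty α)
    pairs α = cartesianProduct allSubs (enumTy α)

    enumTy : (σ : Sort) → List (Ty σ)
    enumTy o       = tt ∷ []
    enumTy (α ⇒ β) = cartesianProduct (allVecs (L.allFin (suc s)) (length (pairs α))) (enumTy β)

  r : Ty o
  r = tt

  decTy : (σ : Sort) → DecidableEquality (Ty σ)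
  decTy o       tt tt = yes refl
  decTy (α ⇒ β) = ×P.≡-dec (VP.≡-dec Fin._≟_) (decTy β)

  decPair : (α : Sort) → DecidableEquality (Sub × Ty α)
  decPair α = ×P.≡-dec (VP.≡-dec Data.Bool._≟_) (decTy α)
    where import Data.Bool

  pairAt : (α : Sort) → Fin (length (pairs α)) → Sub × Ty α
  pairAt α = L.lookup (pairs α)

  emptyMs : (α : Sort) → Ms α
  emptyMs α = replicate _ Fin.zero

  _∪ms_ : ∀ {α} → Ms α → Ms α → Ms α
  _∪ms_ = zipWith _⊕_

  single : (α : Sort) → Sub × Ty α → Ms α
  single α p = tabulate (λ j → if ⌊ decPair α (pairAt α j) p ⌋ then cap 1 else Fin.zero)

  -- Type environments Γ over the variables of Δ: for each variable x,
  -- the s-multiset of pairs (A,σ) such that x:(A,σ) ∈ Γ.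
  Ctx : List Sort → Set
  Ctx []      = ⊤
  Ctx (σ ∷ Δ) = Ms σ × Ctx Δ

  emptyCtx : (Δ : List Sort) → Ctx Δ
  emptyCtx []      = tt
  emptyCtx (σ ∷ Δ) = emptyMs σ , emptyCtx Δ

  _∪c_ : ∀ {Δ} → Ctx Δ → Ctx Δ → Ctx Δ
  _∪c_ {[]}    _ _ = tt
  _∪c_ {σ ∷ Δ} (m , Γ) (m' , Γ') = (m ∪ms m') , (Γ ∪c Γ')

  singleCtx : ∀ {Δ σ} → Δ ∋ σ → Ms σ → Ctx Δ
  singleCtx {σ ∷ Δ} here      m = m , emptyCtx Δ
  singleCtx {τ ∷ Δ} (there x) m = emptyMs τ , singleCtx x m

  restrictMs : ∀ α → Fin s → Ms α → Ms α
  restrictMs α x m = tabulate (λ j → if lookup (proj₁ (pairAt α j)) x then lookup m j else Fin.zero)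

  restrict : ∀ {Δ} → Fin s → Ctx Δ → Ctx Δ
  restrict {[]}    x _       = tt
  restrict {σ ∷ Δ} x (m , Γ) = restrictMs σ x m , restrict x Γ

  size : ∀ {Δ} → Ctx Δ → ℕ
  size {[]}    _       = 0
  size {σ ∷ Δ} (m , Γ) = V.sum (V.map toℕ m) + size Γ

  Val : Set
  Val = Vec ℕ s

  𝟎 : Val
  𝟎 = replicate s 0

  χ : Fin s → Val
  χ i = tabulate (λ j → if ⌊ i Fin.≟ j ⌋ then 1 else 0)

  _+v_ : Val → Val → Val
  _+v_ = zipWith _+_

  Aof : ∀ {Δ} → Ctx Δ → Val → Sub
  Aof Γ v = tabulate (λ x → (0 <ᵇ lookup v x) ∨ (0 <ᵇ size (restrict x Γ)))

  dupl : ∀ {Δ} → List (Ctx Δ) → Val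
  dupl {Δ} Γs = tabulate (λ x →
    sumL (L.map (λ Γ → size (restrict x Γ)) Γs)
      ∸ size (L.foldr _∪c_ (emptyCtx Δ) (L.map (restrict x) Γs)))

  -- Argument families for the (@) rule: for the function type with
  -- multiset m, a family indexed by I in which each pair (A_j,τ_j) of
  -- pairs α occurs exactly (multiplicity of m at j) times; each member
  -- carries its environment Γ_i and its value v_i.
  Fam : (Δ : List Sort) (α : Sort) → Ms α → Set
  Fam Δ α m = (j : Fin (length (pairs α))) → Vec (Ctx Δ × Val) (toℕ (lookup m j))

  flat : ∀ {Δ α} (m : Ms α) → Fam Δ α m → List (Ctx Δ × Val)
  flat {α = α} m F = L.concatMap (λ j → V.toList (F j)) (L.allFin (length (pairs α)))

  appCtx : ∀ {Δ α} (m : Ms α) → Ctx Δ → Fam Δ α m → Ctx Δ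
  appCtx m Γ₀ F = L.foldr _∪c_ Γ₀ (L.map proj₁ (flat m F))

  appVal : ∀ {Δ α} (m : Ms α) → Ctx Δ → Val → Fam Δ α m → Val
  appVal m Γ₀ v₀ F =
    (dupl (Γ₀ ∷ L.map proj₁ (flat m F)) +v v₀) +v L.foldr _+v_ 𝟎 (L.map proj₂ (flat m F))

  -- The type system:  Der Γ M v τ  means  Γ ⊢ M : (v, τ)
  data Der {Δ : List Sort} : ∀ {σ} → Ctx Δ → Tm Δ σ → Val → Ty σ → Set where
    ⊢a   : (i : Fin s) (A : Sub) →
           Der (emptyCtx Δ) (con (a i)) (χ i) (single o (A , r) , r)
    ⊢c   : Der (emptyCtx Δ) (con c) 𝟎 r
    ⊢b₁  : (A : Sub) →
           Der (emptyCtx Δ) (con b) 𝟎 (single o (A , r) , (emptyMs o , r))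
    ⊢b₂  : (A : Sub) →
           Der (emptyCtx Δ) (con b) 𝟎 (emptyMs o , (single o (A , r) , r))
    ⊢var : ∀ {σ} (x : Δ ∋ σ) (A : Sub) (τ : Ty σ) →
           Der (singleCtx x (single σ (A , τ))) (var x) 𝟎 τ
    ⊢lam : ∀ {α β} {Γ : Ctx Δ} {m : Ms α} {K : Tm (α ∷ Δ) β} {v : Val} {τ : Ty β} →
           Der {α ∷ Δ} (m , Γ) K v τ → Der Γ (lam K) v (m , τ)
    ⊢app : ∀ {α β} {Γ₀ : Ctx Δ} {m : Ms α} {K : Tm Δ (α ⇒ β)} {L : Tm Δ α}
             {v₀ : Val} {τ : Ty β} →
           Der Γ₀ K v₀ (m , τ) →
           (F : Fam Δ α m) →
           ((j : Fin (length (pairs α))) (k : Fin (toℕ (lookup m j))) →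
              Der (proj₁ (lookup (F j) k)) L (proj₂ (lookup (F j) k)) (proj₂ (pairAt α j))
              × (Aof (proj₁ (lookup (F j) k)) (proj₂ (lookup (F j) k)) ≡ proj₁ (pairAt α j))) →
           Der (appCtx m Γ₀ F) (app K L) (appVal m Γ₀ v₀ F) τ

-- A closed beta-normal term of sort o is c, ω, a_i L or b L₁ L₂, and ω is untypable.  In the
-- empty environment nothing is duplicated, so the value of a typed a_i L is χ_i plus the values
-- of the derivations provided for its argument, and likewise for b L₁ L₂ with 0 in place of χ_i.
-- Since multisets are multiplicity vectors over duplicate-free enumerations, the type (A, r) → r
-- demands exactly one derivation of its argument and ⊤ → r none, so the branch is continued
-- through that unique typed argument.
{-# OPTIONS --safe #-}
module Submission where

open import Defs
open import Function using (_∘_)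
open import Data.Nat using (ℕ; zero; suc; _+_; _*_; _≤_; _⊓_; z≤n; s≤s)
open import Data.Nat.Properties
  using (+-identityʳ; *-zeroʳ; *-distribˡ-+; *-distribʳ-+; m≤n⇒m⊓n≡m; ≤-trans; n≤1+n)
open import Data.Nat.ListAction using () renaming (sum to sumL)
open import Data.Nat.ListAction.Properties using (sum-++)
open import Data.Bool using (true; false; if_then_else_)
import Data.Bool as Bool
open import Data.Fin as Fin using (Fin; toℕ)
open import Data.Fin.Properties using (toℕ-fromℕ<; suc-injective)
open import Data.List as L
  using (List; []; _∷_; _++_; length; map; concatMap; cartesianProduct; cartesianProductWith; allFin; tabulate)
open import Data.List.Properties using (map-++; map-cong; map-tabulate; tabulate-lookup; length-++)
open import Data.List.Relation.Unary.All as All using (All)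
open import Data.List.Relation.Unary.All.Properties using (concat⁺; map⁺; tabulate⁺)
open import Data.Vec as V using (Vec; lookup)
open import Data.Vec.Properties as VP using (lookup-zipWith; lookup-replicate; lookup∘tabulate; length-toList)
open import Data.Vec.Relation.Unary.All.Properties using (lookup⁻; toList⁺)
open import Data.Product using (Σ; _×_; _,_; proj₁; proj₂)
import Data.Product.Properties as ×P
open import Data.Unit using (tt)
open import Relation.Binary.Definitions using (DecidableEquality)
open import Relation.Binary.PropositionalEquality
  using (_≡_; _≢_; refl; sym; trans; cong; cong₂; subst; module ≡-Reasoning)
open import Relation.Nullary using (Dec; yes; no; ¬_; contradiction)
open import Relation.Nullary.Decidable using (⌊_⌋)

open ≡-Reasoning

𝟙 : {P : Set} → Dec P → ℕ
𝟙 d = if ⌊ d ⌋ then 1 else 0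

𝟙-yes : {P : Set} (d : Dec P) → P → 𝟙 d ≡ 1
𝟙-yes (yes _) _  = refl
𝟙-yes (no ¬p) p = contradiction p ¬p

𝟙-no : {P : Set} (d : Dec P) → ¬ P → 𝟙 d ≡ 0
𝟙-no (yes p) ¬p = contradiction p ¬p
𝟙-no (no _)  _  = refl

𝟙-cong : {P Q : Set} (p : Dec P) (q : Dec Q) → (P → Q) → (Q → P) → 𝟙 p ≡ 𝟙 q
𝟙-cong (yes p) q f _ = sym (𝟙-yes q (f p))
𝟙-cong (no ¬p) q _ g = sym (𝟙-no q (¬p ∘ g))

sum-map-zero : {A : Set} (f : A → ℕ) → (∀ x → f x ≡ 0) → ∀ xs → sumL (map f xs) ≡ 0
sum-map-zero f f≡0 []       = refl
sum-map-zero f f≡0 (x ∷ xs) = cong₂ _+_ (f≡0 x) (sum-map-zero f f≡0 xs)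

map-lookup-allFin : {A B : Set} (f : A → B) (xs : List A) →
                    map (f ∘ L.lookup xs) (allFin (length xs)) ≡ map f xs
map-lookup-allFin f xs = begin
  map (f ∘ L.lookup xs) (allFin (length xs)) ≡⟨ map-tabulate (λ j → j) (f ∘ L.lookup xs) ⟩
  tabulate (f ∘ L.lookup xs)                 ≡⟨ sym (map-tabulate (L.lookup xs) f) ⟩
  map f (tabulate (L.lookup xs))             ≡⟨ cong (map f) (tabulate-lookup xs) ⟩
  map f xs                                   ∎

length-concatMap-toList : {J X : Set} {n : J → ℕ} (F : (j : J) → Vec X (n j)) (js : List J) →
                          length (concatMap (V.toList ∘ F) js) ≡ sumL (map n js)
length-concatMap-toList F []       = refl
length-concatMap-toList F (j ∷ js) =
  trans (length-++ (V.toList (F j))) (cong₂ _+_ (length-toList (F j)) (length-concatMap-toList F js))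

concatMap-map≡cartesianProductWith : {A B C : Set} (g : A → B → C) (xs : List A) (ys : List B) →
  concatMap (λ x → map (g x) ys) xs ≡ cartesianProductWith g xs ys
concatMap-map≡cartesianProductWith g []       ys = refl
concatMap-map≡cartesianProductWith g (x ∷ xs) ys =
  cong (map (g x) ys ++_) (concatMap-map≡cartesianProductWith g xs ys)

length≡0⇒≡[] : {A : Set} (xs : List A) → length xs ≡ 0 → xs ≡ []
length≡0⇒≡[] [] _ = refl

length≡1⇒singleton : {A : Set} (xs : List A) → length xs ≡ 1 → Σ A λ x → xs ≡ x ∷ []
length≡1⇒singleton (x ∷ []) _ = x , refl

multiplicity : {A : Set} → DecidableEquality A → A → List A → ℕ
multiplicity _≟_ x xs = sumL (map (λ y → 𝟙 (y ≟ x)) xs)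

IsEnumeration : {A : Set} → DecidableEquality A → List A → Set
IsEnumeration _≟_ xs = ∀ x → multiplicity _≟_ x xs ≡ 1

module _ {A : Set} (_≟_ : DecidableEquality A) where

  multiplicity-++ : ∀ x xs ys → multiplicity _≟_ x (xs ++ ys) ≡ multiplicity _≟_ x xs + multiplicity _≟_ x ys
  multiplicity-++ x xs ys = trans (cong sumL (map-++ (λ y → 𝟙 (y ≟ x)) xs ys)) (sum-++ (map (λ y → 𝟙 (y ≟ x)) xs) _)

  multiplicity≡0 : ∀ {x xs} → All (_≢ x) xs → multiplicity _≟_ x xs ≡ 0
  multiplicity≡0 All.[]         = refl
  multiplicity≡0 (y≢x All.∷ ys) = cong₂ _+_ (𝟙-no _ y≢x) (multiplicity≡0 ys)

module _ {A B : Set} (_≟ᴬ_ : DecidableEquality A) (_≟ᴮ_ : DecidableEquality B) where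

  multiplicity-map-injective : (f : A → B) → (∀ {x y} → f x ≡ f y → x ≡ y) →
                               ∀ x xs → multiplicity _≟ᴮ_ (f x) (map f xs) ≡ multiplicity _≟ᴬ_ x xs
  multiplicity-map-injective f f-inj x []       = refl
  multiplicity-map-injective f f-inj x (y ∷ ys) =
    cong₂ _+_ (𝟙-cong _ _ f-inj (cong f)) (multiplicity-map-injective f f-inj x ys)

module _ {A B C : Set} (_≟ᴬ_ : DecidableEquality A) (_≟ᴮ_ : DecidableEquality B)
         (_≟ᶜ_ : DecidableEquality C) (g : A → B → C)
         (g-injective : ∀ {x y w z} → g x w ≡ g y z → x ≡ y × w ≡ z) where

  𝟙-injective₂ : ∀ x w y z → 𝟙 (g x w ≟ᶜ g y z) ≡ 𝟙 (x ≟ᴬ y) * 𝟙 (w ≟ᴮ z)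
  𝟙-injective₂ x w y z with x ≟ᴬ y | w ≟ᴮ z
  ... | yes refl | yes refl = 𝟙-yes _ refl
  ... | yes _    | no w≢z   = 𝟙-no _ (w≢z ∘ proj₂ ∘ g-injective)
  ... | no x≢y   | _        = 𝟙-no _ (x≢y ∘ proj₁ ∘ g-injective)

  multiplicity-map₂ : ∀ x y z ws →
    multiplicity _≟ᶜ_ (g y z) (map (g x) ws) ≡ 𝟙 (x ≟ᴬ y) * multiplicity _≟ᴮ_ z ws
  multiplicity-map₂ x y z []       = sym (*-zeroʳ (𝟙 (x ≟ᴬ y)))
  multiplicity-map₂ x y z (w ∷ ws) = begin
    𝟙 (g x w ≟ᶜ g y z) + multiplicity _≟ᶜ_ (g y z) (map (g x) ws)
      ≡⟨ cong₂ _+_ (𝟙-injective₂ x w y z) (multiplicity-map₂ x y z ws) ⟩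
    𝟙 (x ≟ᴬ y) * 𝟙 (w ≟ᴮ z) + 𝟙 (x ≟ᴬ y) * multiplicity _≟ᴮ_ z ws
      ≡⟨ sym (*-distribˡ-+ (𝟙 (x ≟ᴬ y)) _ _) ⟩
    𝟙 (x ≟ᴬ y) * multiplicity _≟ᴮ_ z (w ∷ ws)
      ∎

  multiplicity-cartesianProductWith : ∀ y z xs ws →
    multiplicity _≟ᶜ_ (g y z) (cartesianProductWith g xs ws)
      ≡ multiplicity _≟ᴬ_ y xs * multiplicity _≟ᴮ_ z ws
  multiplicity-cartesianProductWith y z []       ws = refl
  multiplicity-cartesianProductWith y z (x ∷ xs) ws = begin
    multiplicity _≟ᶜ_ (g y z) (map (g x) ws ++ cartesianProductWith g xs ws)
      ≡⟨ multiplicity-++ _≟ᶜ_ (g y z) (map (g x) ws) _ ⟩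
    multiplicity _≟ᶜ_ (g y z) (map (g x) ws) + multiplicity _≟ᶜ_ (g y z) (cartesianProductWith g xs ws)
      ≡⟨ cong₂ _+_ (multiplicity-map₂ x y z ws) (multiplicity-cartesianProductWith y z xs ws) ⟩
    𝟙 (x ≟ᴬ y) * multiplicity _≟ᴮ_ z ws + multiplicity _≟ᴬ_ y xs * multiplicity _≟ᴮ_ z ws
      ≡⟨ sym (*-distribʳ-+ (multiplicity _≟ᴮ_ z ws) (𝟙 (x ≟ᴬ y)) _) ⟩
    multiplicity _≟ᴬ_ y (x ∷ xs) * multiplicity _≟ᴮ_ z ws
      ∎

cartesianProduct-isEnumeration : {A B : Set} (_≟ᴬ_ : DecidableEquality A) (_≟ᴮ_ : DecidableEquality B) →
  ∀ {xs ys} → IsEnumeration _≟ᴬ_ xs → IsEnumeration _≟ᴮ_ ys →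
  IsEnumeration (×P.≡-dec _≟ᴬ_ _≟ᴮ_) (cartesianProduct xs ys)
cartesianProduct-isEnumeration _≟ᴬ_ _≟ᴮ_ {xs} {ys} enum-xs enum-ys (x , y) = begin
  multiplicity (×P.≡-dec _≟ᴬ_ _≟ᴮ_) (x , y) (cartesianProduct xs ys)
    ≡⟨ multiplicity-cartesianProductWith _≟ᴬ_ _≟ᴮ_ (×P.≡-dec _≟ᴬ_ _≟ᴮ_) _,_ ×P.,-injective x y xs ys ⟩
  multiplicity _≟ᴬ_ x xs * multiplicity _≟ᴮ_ y ys
    ≡⟨ cong₂ _*_ (enum-xs x) (enum-ys y) ⟩
  1 ∎

allFin-isEnumeration : ∀ n → IsEnumeration Fin._≟_ (allFin n)
allFin-isEnumeration (suc n) Fin.zero    =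
  cong suc (multiplicity≡0 Fin._≟_ (tabulate⁺ {f = Fin.suc {n}} (λ _ ())))
allFin-isEnumeration (suc n) (Fin.suc j) = begin
  multiplicity Fin._≟_ (Fin.suc j) (tabulate Fin.suc)
    ≡⟨ cong (multiplicity Fin._≟_ (Fin.suc j)) (sym (map-tabulate (λ k → k) Fin.suc)) ⟩
  multiplicity Fin._≟_ (Fin.suc j) (map Fin.suc (allFin n))
    ≡⟨ multiplicity-map-injective Fin._≟_ Fin._≟_ Fin.suc suc-injective j (allFin n) ⟩
  multiplicity Fin._≟_ j (allFin n)
    ≡⟨ allFin-isEnumeration n j ⟩
  1 ∎

bools-isEnumeration : IsEnumeration Bool._≟_ (false ∷ true ∷ [])
bools-isEnumeration false = refl
bools-isEnumeration true  = refl

module _ (s : ℕ) where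

  allVecs-suc : {A : Set} (xs : List A) (n : ℕ) →
                allVecs s xs (suc n) ≡ cartesianProductWith V._∷_ xs (allVecs s xs n)
  allVecs-suc xs n = concatMap-map≡cartesianProductWith V._∷_ xs (allVecs s xs n)

  allVecs-isEnumeration : {A : Set} (_≟_ : DecidableEquality A) {xs : List A} →
    IsEnumeration _≟_ xs → ∀ n → IsEnumeration (VP.≡-dec _≟_) (allVecs s xs n)
  allVecs-isEnumeration _≟_ enum-xs zero    V.[] = refl
  allVecs-isEnumeration _≟_ {xs} enum-xs (suc n) (x V.∷ v) = begin
    multiplicity (VP.≡-dec _≟_) (x V.∷ v) (allVecs s xs (suc n))
      ≡⟨ cong (multiplicity (VP.≡-dec _≟_) (x V.∷ v)) (allVecs-suc xs n) ⟩
    multiplicity (VP.≡-dec _≟_) (x V.∷ v) (cartesianProductWith V._∷_ xs (allVecs s xs n))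
      ≡⟨ multiplicity-cartesianProductWith _≟_ (VP.≡-dec _≟_) (VP.≡-dec _≟_) V._∷_ VP.∷-injective x v xs _ ⟩
    multiplicity _≟_ x xs * multiplicity (VP.≡-dec _≟_) v (allVecs s xs n)
      ≡⟨ cong₂ _*_ (enum-xs x) (allVecs-isEnumeration _≟_ enum-xs n v) ⟩
    1 ∎

  enumTy-isEnumeration : ∀ σ → IsEnumeration (decTy s σ) (enumTy s σ)
  enumTy-isEnumeration o       tt = refl
  enumTy-isEnumeration (α ⇒ β) =
    cartesianProduct-isEnumeration (VP.≡-dec Fin._≟_) (decTy s β)
      {allVecs s (allFin (suc s)) (length (pairs s α))} {enumTy s β}
      (allVecs-isEnumeration Fin._≟_ {allFin (suc s)} (allFin-isEnumeration (suc s)) (length (pairs s α)))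
      (enumTy-isEnumeration β)

  pairs-isEnumeration : ∀ α → IsEnumeration (decPair s α) (pairs s α)
  pairs-isEnumeration α =
    cartesianProduct-isEnumeration (VP.≡-dec Bool._≟_) (decTy s α) {allSubs s} {enumTy s α}
      (allVecs-isEnumeration Bool._≟_ {false ∷ true ∷ []} bools-isEnumeration s) (enumTy-isEnumeration α)

  cardinality : ∀ {α} → Ms s α → ℕ
  cardinality {α} m = sumL (map (λ j → toℕ (lookup m j)) (allFin (length (pairs s α))))

  toℕ-cap : ∀ n → toℕ (cap s n) ≡ n ⊓ s
  toℕ-cap n = toℕ-fromℕ< _

  cardinality-single : 1 ≤ s → ∀ α p → cardinality (single s α p) ≡ 1
  cardinality-single 1≤s α p = begin
    sumL (map (λ j → toℕ (lookup (single s α p) j)) (allFin (length (pairs s α))))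
      ≡⟨ cong sumL (map-cong entry (allFin _)) ⟩
    sumL (map ((λ y → 𝟙 (decPair s α y p)) ∘ L.lookup (pairs s α)) (allFin (length (pairs s α))))
      ≡⟨ cong sumL (map-lookup-allFin (λ y → 𝟙 (decPair s α y p)) (pairs s α)) ⟩
    multiplicity (decPair s α) p (pairs s α)
      ≡⟨ pairs-isEnumeration α p ⟩
    1 ∎
    where
    toℕ-if : ∀ bit → toℕ (if bit then cap s 1 else Fin.zero) ≡ (if bit then 1 else 0)
    toℕ-if true  = trans (toℕ-cap 1) (m≤n⇒m⊓n≡m 1≤s)
    toℕ-if false = refl

    entry : ∀ j → toℕ (lookup (single s α p) j) ≡ 𝟙 (decPair s α (pairAt s α j) p)
    entry j = trans (cong toℕ (lookup∘tabulate _ j)) (toℕ-if _)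

  cardinality-emptyMs : ∀ α → cardinality (emptyMs s α) ≡ 0
  cardinality-emptyMs α =
    sum-map-zero _ (λ j → cong toℕ (lookup-replicate j Fin.zero)) (allFin (length (pairs s α)))

  flat-length : ∀ {Δ α} (m : Ms s α) (F : Fam s Δ α m) → length (flat s m F) ≡ cardinality m
  flat-length m F = length-concatMap-toList F (allFin _)

  flat-All : ∀ {Δ α} {P : Ctx s Δ × Val s → Set} (m : Ms s α) (F : Fam s Δ α m) →
             (∀ j k → P (lookup (F j) k)) → All P (flat s m F)
  flat-All m F P-args = concat⁺ (map⁺ (tabulate⁺ (λ j → toList⁺ (lookup⁻ (P-args j)))))

  lookup-foldr-+v : (vs : List (Val s)) (i : Fin s) →
                    lookup (L.foldr (_+v_ s) (𝟎 s) vs) i ≡ sumL (map (λ v → lookup v i) vs)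
  lookup-foldr-+v []       i = lookup-replicate i 0
  lookup-foldr-+v (v ∷ vs) i = trans (lookup-zipWith _+_ i v _) (cong (lookup v i +_) (lookup-foldr-+v vs i))

  lookup-dupl-closed : (Γs : List (Ctx s [])) (i : Fin s) → lookup (dupl s Γs) i ≡ 0
  lookup-dupl-closed Γs i = trans (lookup∘tabulate _ i) (sum-map-zero _ (λ _ → refl) Γs)

  lookup-appVal-closed : ∀ {α} (m : Ms s α) (v₀ : Val s) (F : Fam s [] α m) (i : Fin s) →
    lookup (appVal s m tt v₀ F) i ≡ lookup v₀ i + sumL (map (λ v → lookup v i) (map proj₂ (flat s m F)))
  lookup-appVal-closed m v₀ F i = begin
    lookup (appVal s m tt v₀ F) i
      ≡⟨ lookup-zipWith _+_ i (_+v_ s (dupl s Γs) v₀) _ ⟩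
    lookup (_+v_ s (dupl s Γs) v₀) i + lookup (L.foldr (_+v_ s) (𝟎 s) vs) i
      ≡⟨ cong₂ _+_ dupl-vanishes (lookup-foldr-+v vs i) ⟩
    lookup v₀ i + sumL (map (λ v → lookup v i) vs)
      ∎
    where
    Γs : List (Ctx s [])
    Γs = tt ∷ map proj₁ (flat s m F)

    vs : List (Val s)
    vs = map proj₂ (flat s m F)

    dupl-vanishes : lookup (_+v_ s (dupl s Γs) v₀) i ≡ lookup v₀ i
    dupl-vanishes = trans (lookup-zipWith _+_ i (dupl s Γs) v₀) (cong (_+ lookup v₀ i) (lookup-dupl-closed Γs i))

  no-argument : ∀ {α} (v₀ : Val s) (F : Fam s [] α (emptyMs s α)) (i : Fin s) →
                lookup (appVal s (emptyMs s α) tt v₀ F) i ≡ lookup v₀ i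
  no-argument {α} v₀ F i = begin
    lookup (appVal s (emptyMs s α) tt v₀ F) i
      ≡⟨ lookup-appVal-closed (emptyMs s α) v₀ F i ⟩
    lookup v₀ i + sumL (map (λ v → lookup v i) (map proj₂ (flat s (emptyMs s α) F)))
      ≡⟨ cong (λ xs → lookup v₀ i + sumL (map (λ v → lookup v i) (map proj₂ xs))) flat≡[] ⟩
    lookup v₀ i + 0
      ≡⟨ +-identityʳ _ ⟩
    lookup v₀ i ∎
    where
    flat≡[] : flat s (emptyMs s α) F ≡ []
    flat≡[] = length≡0⇒≡[] _ (trans (flat-length (emptyMs s α) F) (cardinality-emptyMs α))

  sole-argument : 1 ≤ s → ∀ α p (v₀ : Val s) (F : Fam s [] α (single s α p)) (P : Val s → Set) →
    (∀ j k → P (proj₂ (lookup (F j) k))) →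
    Σ (Val s) λ v → P v × (∀ i → lookup (appVal s (single s α p) tt v₀ F) i ≡ lookup v₀ i + lookup v i)
  sole-argument 1≤s α p v₀ F P P-args
    with length≡1⇒singleton (flat s (single s α p) F)
           (trans (flat-length (single s α p) F) (cardinality-single 1≤s α p))
  ... | x , flat≡[x] = proj₂ x , P-x , value
    where
    P-x : P (proj₂ x)
    P-x = All.head (subst (All (P ∘ proj₂)) flat≡[x] (flat-All (single s α p) F P-args))

    value : ∀ i → lookup (appVal s (single s α p) tt v₀ F) i ≡ lookup v₀ i + lookup (proj₂ x) i
    value i = begin
      lookup (appVal s (single s α p) tt v₀ F) i
        ≡⟨ lookup-appVal-closed (single s α p) v₀ F i ⟩
      lookup v₀ i + sumL (map (λ v → lookup v i) (map proj₂ (flat s (single s α p) F)))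
        ≡⟨ cong (λ xs → lookup v₀ i + sumL (map (λ v → lookup v i) (map proj₂ xs))) flat≡[x] ⟩
      lookup v₀ i + (lookup (proj₂ x) i + 0)
        ≡⟨ cong (lookup v₀ i +_) (+-identityʳ _) ⟩
      lookup v₀ i + lookup (proj₂ x) i ∎

  arity : Sort → ℕ
  arity o       = 0
  arity (_ ⇒ β) = suc (arity β)

  closedNeutral-arity≤2 : ∀ {σ} (K : Tm s [] σ) → BetaNormal s K → isLam s K ≡ false → arity σ ≤ 2
  closedNeutral-arity≤2 (var ())    _ _
  closedNeutral-arity≤2 (con (a _)) _ _ = s≤s z≤n
  closedNeutral-arity≤2 (con b)     _ _ = s≤s (s≤s z≤n)
  closedNeutral-arity≤2 (con c)     _ _ = z≤n
  closedNeutral-arity≤2 (con ω)     _ _ = z≤n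
  closedNeutral-arity≤2 (lam _)     _ ()
  closedNeutral-arity≤2 (app K _) (napp notLam nK _) _ =
    ≤-trans (n≤1+n _) (closedNeutral-arity≤2 K nK notLam)

  lookup-χ : ∀ i j → lookup (χ s i) j ≡ 𝟙 (j Fin.≟ i)
  lookup-χ i j = trans (lookup∘tabulate _ j) (𝟙-cong (i Fin.≟ j) (j Fin.≟ i) sym sym)

  HasBranch : Tm s [] o → Val s → Set
  HasBranch M v = Σ (List (Label s)) λ w → Branch s (BT s M) w × (∀ i → occ s i w ≡ lookup v i)

  hasBranch : 1 ≤ s → (M : Tm s [] o) → BetaNormal s M → ∀ {v} → Der s tt M v (r s) → HasBranch M v
  hasBranch _ (var ()) _ _
  hasBranch _ (con c) _ ⊢c = lc ∷ [] , brC , λ i → sym (lookup-replicate i 0)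
  hasBranch _ (con ω) _ ()
  hasBranch _ (app (var ()) _) _ _
  hasBranch _ (app (lam _) _) (napp () _ _) _
  hasBranch 1≤s (app (con (a i)) L) (napp _ _ nL) (⊢app (⊢a _ A) F args) =
    let (v , D , value) = sole-argument 1≤s o (A , r s) (χ s i) F (λ v → Der s tt L v (r s))
          (λ j k → proj₁ (args j k))
        (w , br , occ≡) = hasBranch 1≤s L nL D
    in la i ∷ w , brA br , λ i′ → begin
      𝟙 (i′ Fin.≟ i) + occ s i′ w          ≡⟨ cong₂ _+_ (sym (lookup-χ i i′)) (occ≡ i′) ⟩
      lookup (χ s i) i′ + lookup v i′      ≡⟨ sym (value i′) ⟩
      lookup (appVal s (single s o (A , r s)) tt (χ s i) F) i′  ∎
  hasBranch _ (app (app (var ()) _) _) _ _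
  hasBranch _ (app (app (lam _) _) _) (napp _ (napp () _ _) _) _
  hasBranch 1≤s (app (app (con b) L) _) (napp _ (napp _ _ nL) _) (⊢app (⊢app (⊢b₁ A) F₁ args₁) F₂ _) =
    let (v , D , value) = sole-argument 1≤s o (A , r s) (𝟎 s) F₁ (λ v → Der s tt L v (r s))
          (λ j k → proj₁ (args₁ j k))
        (w , br , occ≡) = hasBranch 1≤s L nL D
    in lb ∷ w , brB₁ br , λ i → begin
      occ s i w                           ≡⟨ occ≡ i ⟩
      lookup v i                          ≡⟨ cong (_+ lookup v i) (sym (lookup-replicate i 0)) ⟩
      lookup (𝟎 s) i + lookup v i         ≡⟨ sym (value i) ⟩
      lookup (appVal s (single s o (A , r s)) tt (𝟎 s) F₁) i ≡⟨ sym (no-argument _ F₂ i) ⟩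
      lookup (appVal s (emptyMs s o) tt (appVal s (single s o (A , r s)) tt (𝟎 s) F₁) F₂) i ∎
  hasBranch 1≤s (app (app (con b) _) L) (napp _ _ nL) (⊢app (⊢app (⊢b₂ A) F₁ _) F₂ args₂) =
    let (v , D , value) = sole-argument 1≤s o (A , r s) (appVal s (emptyMs s o) tt (𝟎 s) F₁) F₂ (λ v → Der s tt L v (r s))
          (λ j k → proj₁ (args₂ j k))
        (w , br , occ≡) = hasBranch 1≤s L nL D
    in lb ∷ w , brB₂ br , λ i → begin
      occ s i w                                    ≡⟨ occ≡ i ⟩
      lookup v i                                   ≡⟨ cong (_+ lookup v i) (sym (lookup-replicate i 0)) ⟩
      lookup (𝟎 s) i + lookup v i                  ≡⟨ cong (_+ lookup v i) (sym (no-argument _ F₁ i)) ⟩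
      lookup (appVal s (emptyMs s o) tt (𝟎 s) F₁) i + lookup v i ≡⟨ sym (value i) ⟩
      lookup (appVal s (single s o (A , r s)) tt (appVal s (emptyMs s o) tt (𝟎 s) F₁) F₂) i ∎
  hasBranch _ (app (app (app K _) _) _) (napp _ (napp _ (napp notLam nK _) _) _) _
    with closedNeutral-arity≤2 K nK notLam
  ... | s≤s (s≤s ())

lemma10 : (s : ℕ) → 1 ≤ s →
    (M : Tm s [] o) → BetaNormal s M →
    (v : Val s) → Der s (emptyCtx s []) M v (r s) →
    Σ (List (Label s)) (λ w → Branch s (BT s M) w × ((i : Fin s) → occ s i w ≡ lookup v i))
lemma10 s 1≤s M normal _ D = hasBranch s 1≤s M normal D
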